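{- Let $r$ be a positive integer, $\mathbb{K}$ a field containing a primitive $r$-th root of unity $z$, and $G$ a chordal graph with perfect elimination ordering $(v_1,\dots,v_\ell)$; let $x_i$ be the coordinate of $\mathbb{K}^\ell$ corresponding to $v_i$. For a subgraph $H$ of $G$ with vertex set $V(H)$, let $$\mathcal{M}(H,r)=\{\ker(x_i-z^kx_j)\mid \{v_i,v_j\}\in E(H),\ 1\le k\le r\}\cup\{\ker x_i\mid v_i\in V(H)\},$$ an arrangement in $\mathbb{K}^\ell$. Let $G_i$ be the subgraph of $G$ induced by $\{v_1,\dots,v_i\}$ ($G_0$ empty). Then $\mathcal{M}(G,r)$ is supersolvable, with filtration $\mathcal{A}_i=\mathcal{M}(G_i,r)$, $i=0,\dots,\ell$.
   Context: A perfect elimination ordering of a graph is an ordering $(v_1,\dots,v_\ell)$ of its vertices such that for every $i$, any two distinct vertices of $\{v_1,\dots,v_{i-1}\}$ adjacent to $v_i$ are adjacent to each other. A central arrangement $\mathcal{A}$ of rank $\ell$ is supersolvable with filtration $\varnothing=\mathcal{A}_0\subseteq\mathcal{A}_1\subseteq\dots\subseteq\mathcal{A}_\ell=\mathcal{A}$ if for each $i\in[\ell]$, $\operatorname{rank}\mathcal{A}_i=i$, and for any distinct $H,H'\in\mathcal{A}_i\setminus\mathcal{A}_{i-1}$ there is $H''\in\mathcal{A}_{i-1}$ with $H\cap H'\subseteq H''$. -}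

module Defs where

open import Level using (Level; _⊔_) renaming (zero to lzero)
open import Algebra.Bundles using (CommutativeRing)
open import Data.Nat as ℕ using (ℕ; zero; suc)
open import Data.Fin as Fin using (Fin; toℕ)
open import Data.Bool using (if_then_else_)
open import Data.Product using (Σ; ∃; _×_; _,_)
open import Data.Sum using (_⊎_)
open import Data.Unit using (⊤)
open import Relation.Nullary using (¬_; does)
open import Relation.Binary.PropositionalEquality using (_≢_)

record IsField {c ℓ : Level} (R : CommutativeRing c ℓ) : Set (c ⊔ ℓ) where
  open CommutativeRing R
  field
    nontrivial : ¬ (1# ≈ 0#)
    inverse    : ∀ x → ¬ (x ≈ 0#) → ∃ λ y → x * y ≈ 1#

-- A finite simple graph on the vertex set Fin n.
-- Vertex i (0-indexed) plays the role of v_{i+1} of the ordering.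
record SimpleGraph (n : ℕ) : Set₁ where
  field
    Adj   : Fin n → Fin n → Set
    sym   : ∀ {a b} → Adj a b → Adj b a
    irrfl : ∀ {a} → ¬ Adj a a

IsPEO : ∀ {n} → SimpleGraph n → Set
IsPEO {n} G = ∀ (i j k : Fin n) → j Fin.< i → k Fin.< i → j ≢ k →
  Adj i j → Adj i k → Adj j k
  where open SimpleGraph G

-- vertex set of G_i = {v_1, ..., v_i}
Prefix : ∀ {n} → ℕ → Fin n → Set
Prefix i a = toℕ a ℕ.< i

AllVertices : ∀ {n} → Fin n → Set
AllVertices _ = ⊤

module _ {c ℓ : Level} (R : CommutativeRing c ℓ) where
  open CommutativeRing R

  pow : Carrier → ℕ → Carrier
  pow x zero    = 1#
  pow x (suc k) = x * pow x k

  IsPrimitiveRoot : ℕ → Carrier → Set ℓ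
  IsPrimitiveRoot r z = (pow z r ≈ 1#) × (∀ k → 1 ℕ.≤ k → k ℕ.< r → ¬ (pow z k ≈ 1#))

  ∑ : ∀ {m} → (Fin m → Carrier) → Carrier
  ∑ {zero}  f = 0#
  ∑ {suc m} f = f Fin.zero + ∑ (λ i → f (Fin.suc i))

  Vec : ℕ → Set c
  Vec n = Fin n → Carrier

  Form : ℕ → Set c
  Form n = Fin n → Carrier

  eval : ∀ {n} → Form n → Vec n → Carrier
  eval f v = ∑ (λ j → f j * v j)

  ker : ∀ {n} → Form n → Vec n → Set ℓ
  ker f v = eval f v ≈ 0#

  SameHyp : ∀ {n} → Form n → Form n → Set (c ⊔ ℓ)
  SameHyp f g = ∀ v → (ker f v → ker g v) × (ker g v → ker f v)

  -- An arrangement is given by the set of its defining forms; its hyperplanes are their kernels.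
  Arr : ℕ → Set (Level.suc (c ⊔ ℓ))
  Arr n = Form n → Set (c ⊔ ℓ)

  HypIn : ∀ {n} → Arr n → Form n → Set (c ⊔ ℓ)
  HypIn A f = ∃ λ g → A g × SameHyp f g

  Center : ∀ {n} → Arr n → Vec n → Set (c ⊔ ℓ)
  Center A v = ∀ f → A f → ker f v

  LinIndep : ∀ {n m} → (Fin m → Vec n) → Set (c ⊔ ℓ)
  LinIndep {n} {m} vs = ∀ (a : Fin m → Carrier) →
    (∀ j → ∑ (λ k → a k * vs k j) ≈ 0#) → ∀ k → a k ≈ 0#

  -- rank A = i, i.e. codim of the center of A is i: the center has a basis of n ∸ i vectors
  HasRank : ∀ {n} → Arr n → ℕ → Set (c ⊔ ℓ)
  HasRank {n} A i = (i ℕ.≤ n) × (Σ (Fin (n ℕ.∸ i) → Vec n) λ vs →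
      (∀ k → Center A (vs k)) × LinIndep vs ×
      (∀ v → Center A v → ∃ λ (a : Fin (n ℕ.∸ i) → Carrier) →
          ∀ j → v j ≈ ∑ (λ k → a k * vs k j)))

  -- F is a supersolvable filtration A_0 ⊆ A_1 ⊆ ... ⊆ A_n = A (equalities/inclusions
  -- are of sets of hyperplanes)
  record IsSupersolvableFiltration {n : ℕ} (A : Arr n) (F : ℕ → Arr n) : Set (c ⊔ ℓ) where
    field
      empty0 : ∀ f → ¬ F 0 f
      mono   : ∀ i → i ℕ.< n → ∀ f → F i f → HypIn (F (suc i)) f
      topˡ   : ∀ f → F n f → HypIn A f
      topʳ   : ∀ f → A f → HypIn (F n) f
      rank   : ∀ i → 1 ℕ.≤ i → i ℕ.≤ n → HasRank (F i) i
      modular : ∀ i → i ℕ.< n → ∀ f f' → F (suc i) f → F (suc i) f' →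
        ¬ HypIn (F i) f → ¬ HypIn (F i) f' → ¬ SameHyp f f' →
        ∃ λ g → F i g × (∀ v → ker f v → ker f' v → ker g v)

  IsSupersolvable : ∀ {n} → Arr n → Set (Level.suc (c ⊔ ℓ))
  IsSupersolvable {n} A = ∃ λ (F : ℕ → Arr n) → IsSupersolvableFiltration A F

  coord : ∀ {n} → Fin n → Form n
  coord a j = if does (j Fin.≟ a) then 1# else 0#

  diffForm : ∀ {n} → Carrier → ℕ → Fin n → Fin n → Form n
  diffForm z k a b j = coord a j - pow z k * coord b j

  -- M(H, r) for H the subgraph of G induced by the vertex set {a | P a}
  M : ∀ {n} → SimpleGraph n → (Fin n → Set) → ℕ → Carrier → Arr n
  M {n} G P r z f = Level.Lift (c ⊔ ℓ) (
    (Σ (Fin n) λ a → Σ (Fin n) λ b → Σ ℕ λ k →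
       P a × P b × SimpleGraph.Adj G a b × 1 ℕ.≤ k × k ℕ.≤ r ×
       (∀ j → f j ≈ diffForm z k a b j))
    ⊎ (Σ (Fin n) λ a → P a × (∀ j → f j ≈ coord a j)))

-- The center of
-- A_i = M(G_i, r) is the coordinate subspace x_1 = ⋯ = x_i = 0, so rank A_i = i.
-- A hyperplane of A_{i+1} ∖ A_i is ker x_{i+1} or ker(x_{i+1} − ζ x_b) with b ≤ i
-- adjacent to v_{i+1} and ζ an r-th root of unity.  Two of them meet inside
-- ker x_b, or, for two distinct earlier neighbours b, b' of v_{i+1}, inside
-- ker(x_b − ζ' x_b'); the latter lies in A_i because b and b' are adjacent by
-- the elimination property.
module Submission where

open import Defs
open import Level using (Level; _⊔_; lift)
open import Algebra.Bundles using (CommutativeRing)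
open import Data.Nat as ℕ using (ℕ; zero; suc; _≤_; _<_; NonZero)
open import Data.Nat.DivMod using (_%_; _/_; m≡m%n+[m/n]*n; m%n<n)
import Data.Nat.Properties as ℕₚ
open import Data.Fin as Fin using (Fin; toℕ; fromℕ<)
import Data.Fin.Properties as Finₚ
open import Data.Product using (_×_; _,_; ∃; proj₁; proj₂)
open import Data.Sum using (inj₁; inj₂)
open import Data.Unit using (tt)
open import Data.Empty using (⊥-elim)
open import Function using (_∘_; _⇔_; mk⇔; Equivalence; Injective)
open import Relation.Nullary using (¬_; yes; no)
open import Relation.Binary.Definitions using (tri<; tri≈; tri>)
open import Relation.Binary.PropositionalEquality as ≡ using (_≡_; _≢_)
import Algebra.Properties.Ring as RingProperties

open Equivalence using (to; from)

module LinearForms {c ℓ : Level} (K : CommutativeRing c ℓ) where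
  open CommutativeRing K
  open RingProperties ring using (-‿distribˡ-*; x∙y⁻¹≈ε⇒x≈y; x≈y⇒x∙y⁻¹≈ε)
  open import Algebra.Properties.Semiring.Sum semiring
    using (sum; sum-cong-≋; sum-replicate-zero; ∑-distrib-+; *-distribˡ-sum)
  open import Relation.Binary.Reasoning.Setoid setoid

  ∑≡sum : ∀ {m} (f : Fin m → Carrier) → ∑ K f ≡ sum f
  ∑≡sum {zero}  f = ≡.refl
  ∑≡sum {suc m} f = ≡.cong (f Fin.zero +_) (∑≡sum (f ∘ Fin.suc))

  ∑-cong : ∀ {m} {f g : Fin m → Carrier} → (∀ j → f j ≈ g j) → ∑ K f ≈ ∑ K g
  ∑-cong {f = f} {g} f≈g rewrite ∑≡sum f | ∑≡sum g = sum-cong-≋ f≈g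

  ∑-zero : ∀ {m} {f : Fin m → Carrier} → (∀ j → f j ≈ 0#) → ∑ K f ≈ 0#
  ∑-zero {m} f≈0 =
    trans (∑-cong f≈0) (trans (reflexive (∑≡sum {m} (λ _ → 0#))) (sum-replicate-zero m))

  ∑-+ : ∀ {m} (f g : Fin m → Carrier) → ∑ K (λ j → f j + g j) ≈ ∑ K f + ∑ K g
  ∑-+ f g rewrite ∑≡sum (λ j → f j + g j) | ∑≡sum f | ∑≡sum g = ∑-distrib-+ f g

  *-distribˡ-∑ : ∀ {m} x (f : Fin m → Carrier) → x * ∑ K f ≈ ∑ K (λ j → x * f j)
  *-distribˡ-∑ x f rewrite ∑≡sum f | ∑≡sum (λ j → x * f j) = *-distribˡ-sum x f

  ∑-single : ∀ {m} (a : Fin m) {f : Fin m → Carrier} →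
    (∀ j → j ≢ a → f j ≈ 0#) → ∑ K f ≈ f a
  ∑-single Fin.zero    f≈0 =
    trans (+-congˡ (∑-zero (λ j → f≈0 (Fin.suc j) λ ()))) (+-identityʳ _)
  ∑-single (Fin.suc a) f≈0 =
    trans (+-cong (f≈0 Fin.zero λ ())
                  (∑-single a (λ j j≢a → f≈0 (Fin.suc j) (j≢a ∘ Finₚ.suc-injective))))
          (+-identityˡ _)

  coord-diag : ∀ {n} (a : Fin n) → coord K a a ≡ 1#
  coord-diag a with a Fin.≟ a
  ... | yes _   = ≡.refl
  ... | no a≢a = ⊥-elim (a≢a ≡.refl)

  coord-offdiag : ∀ {n} {a j : Fin n} → j ≢ a → coord K a j ≡ 0#
  coord-offdiag {a = a} {j} j≢a with j Fin.≟ a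
  ... | yes j≡a = ⊥-elim (j≢a j≡a)
  ... | no _    = ≡.refl

  ∑-coord : ∀ {m n} {s : Fin m → Fin n} → Injective _≡_ _≡_ s →
    (x : Fin m → Carrier) (k₀ : Fin m) → ∑ K (λ k → x k * coord K (s k) (s k₀)) ≈ x k₀
  ∑-coord {s = s} s-inj x k₀ =
    trans (∑-single k₀ (λ k k≢k₀ →
            trans (*-congˡ (reflexive (coord-offdiag (k≢k₀ ∘ ≡.sym ∘ s-inj)))) (zeroʳ _)))
          (trans (*-congˡ (reflexive (coord-diag (s k₀)))) (*-identityʳ _))

  ∑-coord-∉ : ∀ {m n} {s : Fin m → Fin n} {j : Fin n} → (∀ k → s k ≢ j) →
    (x : Fin m → Carrier) → ∑ K (λ k → x k * coord K (s k) j) ≈ 0#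
  ∑-coord-∉ s≢j x = ∑-zero (λ k →
    trans (*-congˡ (reflexive (coord-offdiag (s≢j k ∘ ≡.sym)))) (zeroʳ _))

  eval-cong : ∀ {n} {f g : Form K n} (v : Vec K n) → (∀ j → f j ≈ g j) →
    eval K f v ≈ eval K g v
  eval-cong v f≈g = ∑-cong (λ j → *-congʳ (f≈g j))

  eval-coord : ∀ {n} (a : Fin n) (v : Vec K n) → eval K (coord K a) v ≈ v a
  eval-coord a v =
    trans (∑-single a (λ j j≢a → trans (*-congʳ (reflexive (coord-offdiag j≢a))) (zeroˡ _)))
          (trans (*-congʳ (reflexive (coord-diag a))) (*-identityˡ _))

  eval-linear : ∀ {n} (f g : Form K n) x (v : Vec K n) →
    eval K (λ j → f j - x * g j) v ≈ eval K f v - x * eval K g v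
  eval-linear f g x v = begin
    ∑ K (λ j → (f j - x * g j) * v j)     ≈⟨ ∑-cong expand ⟩
    ∑ K (λ j → fv j + - x * gv j)         ≈⟨ ∑-+ fv (λ j → - x * gv j) ⟩
    eval K f v + ∑ K (λ j → - x * gv j)   ≈⟨ +-congˡ (*-distribˡ-∑ (- x) gv) ⟨
    eval K f v + - x * eval K g v         ≈⟨ +-congˡ (-‿distribˡ-* x _) ⟨
    eval K f v - x * eval K g v           ∎
    where
    fv gv : Fin _ → Carrier
    fv j = f j * v j
    gv j = g j * v j
    expand : ∀ j → (f j - x * g j) * v j ≈ fv j + - x * gv j
    expand j = trans (distribʳ (v j) (f j) (- (x * g j)))
      (+-congˡ (trans (*-congʳ (-‿distribˡ-* x (g j))) (*-assoc (- x) (g j) (v j))))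

  eval-diffForm : ∀ {n} z k (a b : Fin n) (v : Vec K n) →
    eval K (diffForm K z k a b) v ≈ v a - pow K z k * v b
  eval-diffForm z k a b v = trans (eval-linear (coord K a) (coord K b) (pow K z k) v)
    (+-cong (eval-coord a v) (-‿cong (*-congˡ (eval-coord b v))))

  Cuts : ∀ {n} → Form K n → (Vec K n → Set ℓ) → Set (c ⊔ ℓ)
  Cuts f P = ∀ v → ker K f v ⇔ P v

  cuts-cong : ∀ {n} {f g : Form K n} {P : Vec K n → Set ℓ} →
    (∀ j → f j ≈ g j) → Cuts g P → Cuts f P
  cuts-cong f≈g g-cuts v = mk⇔
    (λ fv≈0 → to (g-cuts v) (trans (sym (eval-cong v f≈g)) fv≈0))
    (λ Pv → trans (eval-cong v f≈g) (from (g-cuts v) Pv))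

  cuts-resp : ∀ {n} {f : Form K n} {P Q : Vec K n → Set ℓ} →
    Cuts f P → (∀ v → P v ⇔ Q v) → Cuts f Q
  cuts-resp f-cuts P⇔Q v = mk⇔ (to (P⇔Q v) ∘ to (f-cuts v)) (from (f-cuts v) ∘ from (P⇔Q v))

  cuts-sameHyp : ∀ {n} {f g : Form K n} {P : Vec K n → Set ℓ} →
    Cuts f P → Cuts g P → SameHyp K f g
  cuts-sameHyp f-cuts g-cuts v =
    from (g-cuts v) ∘ to (f-cuts v) , from (f-cuts v) ∘ to (g-cuts v)

  cuts-coord : ∀ {n} (a : Fin n) → Cuts (coord K a) (λ v → v a ≈ 0#)
  cuts-coord a v = mk⇔ (trans (sym (eval-coord a v))) (trans (eval-coord a v))

  cuts-diffForm : ∀ {n} z k (a b : Fin n) →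
    Cuts (diffForm K z k a b) (λ v → v a ≈ pow K z k * v b)
  cuts-diffForm z k a b v = mk⇔
    (λ h → x∙y⁻¹≈ε⇒x≈y _ _ (trans (sym (eval-diffForm z k a b v)) h))
    (λ h → trans (eval-diffForm z k a b v) (x≈y⇒x∙y⁻¹≈ε h))

  ZeroBelow : ∀ {n} → ℕ → Vec K n → Set ℓ
  ZeroBelow i v = ∀ a → toℕ a < i → v a ≈ 0#

  hasRank-coordinate : ∀ {n} (A : Arr K n) i → i ≤ n →
    (∀ v → Center K A v ⇔ ZeroBelow i v) → HasRank K A i
  hasRank-coordinate {n} A i i≤n center⇔ =
    i≤n , basis , basis-central , basis-independent , basis-spans
    where
    shift : Fin (n ℕ.∸ i) → Fin n
    shift k = fromℕ< (≡.subst (i ℕ.+ toℕ k <_) (ℕₚ.m+[n∸m]≡n i≤n)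
                              (ℕₚ.+-monoʳ-< i (Finₚ.toℕ<n k)))

    toℕ-shift : ∀ k → toℕ (shift k) ≡ i ℕ.+ toℕ k
    toℕ-shift k = Finₚ.toℕ-fromℕ< _

    shift-injective : Injective _≡_ _≡_ shift
    shift-injective {k} {k'} e = Finₚ.toℕ-injective (ℕₚ.+-cancelˡ-≡ i _ _
      (≡.trans (≡.sym (toℕ-shift k)) (≡.trans (≡.cong toℕ e) (toℕ-shift k'))))

    shift-onto : ∀ j → i ≤ toℕ j → ∃ λ k → shift k ≡ j
    shift-onto j i≤j = k , Finₚ.toℕ-injective
      (≡.trans (toℕ-shift k)
        (≡.trans (≡.cong (i ℕ.+_) (Finₚ.toℕ-fromℕ< j-i<n-i)) (ℕₚ.m+[n∸m]≡n i≤j)))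
      where
      j-i<n-i = ℕₚ.∸-monoˡ-< (Finₚ.toℕ<n j) i≤j
      k = fromℕ< j-i<n-i

    i≤shift : ∀ k → i ≤ toℕ (shift k)
    i≤shift k = ≡.subst (i ≤_) (≡.sym (toℕ-shift k)) (ℕₚ.m≤m+n i _)

    below≢shift : ∀ {a} k → toℕ a < i → shift k ≢ a
    below≢shift k a<i ≡.refl = ℕₚ.<⇒≱ a<i (i≤shift k)

    basis : Fin (n ℕ.∸ i) → Vec K n
    basis k = coord K (shift k)

    basis-central : ∀ k → Center K A (basis k)
    basis-central k = from (center⇔ (basis k))
      (λ a a<i → reflexive (coord-offdiag (below≢shift k a<i ∘ ≡.sym)))

    basis-independent : LinIndep K basis
    basis-independent x x·basis≈0 k =
      trans (sym (∑-coord shift-injective x k)) (x·basis≈0 (shift k))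

    basis-spans : ∀ v → Center K A v → ∃ λ (x : Fin (n ℕ.∸ i) → Carrier) →
      ∀ j → v j ≈ ∑ K (λ k → x k * basis k j)
    basis-spans v v-central = v ∘ shift , component
      where
      component : ∀ j → v j ≈ ∑ K (λ k → v (shift k) * basis k j)
      component j with i ℕₚ.≤? toℕ j
      ... | no i≰j  = trans (to (center⇔ v) v-central j j<i)
                            (sym (∑-coord-∉ (λ k → below≢shift k j<i) (v ∘ shift)))
        where j<i = ℕₚ.≰⇒> i≰j
      ... | yes i≤j with shift-onto j i≤j
      ...   | k , ≡.refl = sym (∑-coord shift-injective (v ∘ shift) k)

module Units {c ℓ : Level} (K : CommutativeRing c ℓ) where
  open CommutativeRing K
  open RingProperties ring using ([y-z]x≈yx-zx; x∙y⁻¹≈ε⇒x≈y; x≈y⇒x∙y⁻¹≈ε)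
  open import Relation.Binary.Reasoning.Setoid setoid

  unit-transpose : ∀ {u w x y} → u * w ≈ 1# → x ≈ u * y → y ≈ w * x
  unit-transpose {u} {w} {x} {y} uw≈1 x≈uy = begin
    y           ≈⟨ *-identityˡ y ⟨
    1# * y      ≈⟨ *-congʳ (trans (*-comm w u) uw≈1) ⟨
    (w * u) * y ≈⟨ *-assoc w u y ⟩
    w * (u * y) ≈⟨ *-congˡ x≈uy ⟨
    w * x       ∎

  unit-cancel : ∀ {u w x y} → u * w ≈ 1# → u * x ≈ u * y → x ≈ y
  unit-cancel {u} {w} {x} {y} uw≈1 ux≈uy = trans
    (unit-transpose uw≈1 (sym ux≈uy))
    (sym (unit-transpose uw≈1 refl))

  -- In a field 1 − u is invertible as soon as u ≉ 1.
  x≈u*x⇒x≈0 : IsField K → ∀ {u x} → ¬ (u ≈ 1#) → x ≈ u * x → x ≈ 0#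
  x≈u*x⇒x≈0 isField {u} {x} u≉1 x≈ux
    with IsField.inverse isField (1# - u) (u≉1 ∘ sym ∘ x∙y⁻¹≈ε⇒x≈y 1# u)
  ... | w , [1-u]w≈1 = unit-cancel [1-u]w≈1 (begin
    (1# - u) * x   ≈⟨ [y-z]x≈yx-zx x 1# u ⟩
    1# * x - u * x ≈⟨ x≈y⇒x∙y⁻¹≈ε (trans (*-identityˡ x) x≈ux) ⟩
    0#             ≈⟨ zeroʳ (1# - u) ⟨
    (1# - u) * 0#  ∎)

module RootsOfUnity {c ℓ : Level} (K : CommutativeRing c ℓ) (z : CommutativeRing.Carrier K) where
  open CommutativeRing K
  open Units K
  open import Relation.Binary.Reasoning.Setoid setoid

  pow-+ : ∀ m n → pow K z (m ℕ.+ n) ≈ pow K z m * pow K z n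
  pow-+ zero    n = sym (*-identityˡ _)
  pow-+ (suc m) n = trans (*-congˡ (pow-+ m n)) (sym (*-assoc _ _ _))

  module Period (r : ℕ) (1≤r : 1 ≤ r) (zʳ≈1 : pow K z r ≈ 1#) where
    instance
      r≢0 : NonZero r
      r≢0 = ℕ.>-nonZero 1≤r

    pow-multiple : ∀ q → pow K z (q ℕ.* r) ≈ 1#
    pow-multiple zero    = refl
    pow-multiple (suc q) =
      trans (pow-+ r (q ℕ.* r)) (trans (*-cong zʳ≈1 (pow-multiple q)) (*-identityˡ 1#))

    pow-mod : ∀ m → pow K z m ≈ pow K z (m % r)
    pow-mod m = begin
      pow K z m                               ≡⟨ ≡.cong (pow K z) (m≡m%n+[m/n]*n m r) ⟩
      pow K z (m % r ℕ.+ (m / r) ℕ.* r)       ≈⟨ pow-+ (m % r) _ ⟩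
      pow K z (m % r) * pow K z ((m / r) ℕ.* r) ≈⟨ *-congˡ (pow-multiple (m / r)) ⟩
      pow K z (m % r) * 1#                    ≈⟨ *-identityʳ _ ⟩
      pow K z (m % r)                         ∎

    -- A remainder 0 is replaced by r, as z⁰ = zʳ.
    pow-positive-exponent : ∀ m → ∃ λ k → 1 ≤ k × k ≤ r × pow K z m ≈ pow K z k
    pow-positive-exponent m with m % r ℕₚ.≟ 0
    ... | yes m%r≡0 = r , 1≤r , ℕₚ.≤-refl ,
      trans (pow-mod m) (trans (reflexive (≡.cong (pow K z) m%r≡0)) (sym zʳ≈1))
    ... | no m%r≢0  = m % r , ℕₚ.n≢0⇒n>0 m%r≢0 , ℕₚ.<⇒≤ (m%n<n m r) , pow-mod m

    pow-inverse : ∀ {k} → k ≤ r → pow K z k * pow K z (r ℕ.∸ k) ≈ 1#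
    pow-inverse {k} k≤r = trans (sym (pow-+ k (r ℕ.∸ k)))
      (trans (reflexive (≡.cong (pow K z) (ℕₚ.m+[n∸m]≡n k≤r))) zʳ≈1)

    pow-transpose : ∀ {k x y} → k ≤ r →
      (x ≈ pow K z k * y) ⇔ (y ≈ pow K z (r ℕ.∸ k) * x)
    pow-transpose k≤r = mk⇔ (unit-transpose (pow-inverse k≤r))
      (unit-transpose (trans (*-comm _ _) (pow-inverse k≤r)))

    pow-mod-⇔ : ∀ {k x y} → (x ≈ pow K z k * y) ⇔ (x ≈ pow K z (k % r) * y)
    pow-mod-⇔ {k} = mk⇔ (λ h → trans h (*-congʳ (pow-mod k)))
                        (λ h → trans h (*-congʳ (sym (pow-mod k))))

    module _ (isField : IsField K) (z-primitive : IsPrimitiveRoot K r z) where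

      pow-<-distinct : ∀ {e e' x} → e < e' → e' < r →
        pow K z e * x ≈ pow K z e' * x → x ≈ 0#
      pow-<-distinct {e} {e'} {x} e<e' e'<r zᵉx≈zᵉ'x = x≈u*x⇒x≈0 isField
        (proj₂ z-primitive d (ℕₚ.m<n⇒0<n∸m e<e') (ℕₚ.≤-<-trans (ℕₚ.m∸n≤m e' e) e'<r))
        (unit-cancel (pow-inverse (ℕₚ.<⇒≤ (ℕₚ.<-trans e<e' e'<r))) (begin
          pow K z e * x                ≈⟨ zᵉx≈zᵉ'x ⟩
          pow K z e' * x               ≡⟨ ≡.cong (λ m → pow K z m * x) e+d≡e' ⟨
          pow K z (e ℕ.+ d) * x        ≈⟨ *-congʳ (pow-+ e d) ⟩
          (pow K z e * pow K z d) * x  ≈⟨ *-assoc _ _ _ ⟩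
          pow K z e * (pow K z d * x)  ∎))
        where
        d = e' ℕ.∸ e
        e+d≡e' = ℕₚ.m+[n∸m]≡n (ℕₚ.<⇒≤ e<e')

      pow-distinct : ∀ {e e' x} → e < r → e' < r → e ≢ e' →
        pow K z e * x ≈ pow K z e' * x → x ≈ 0#
      pow-distinct {e} {e'} e<r e'<r e≢e' h with ℕₚ.<-cmp e e'
      ... | tri< e<e' _ _ = pow-<-distinct e<e' e'<r h
      ... | tri≈ _ e≡e' _ = ⊥-elim (e≢e' e≡e')
      ... | tri> _ _ e'<e = pow-<-distinct e'<e e<r (sym h)

module ChordalArrangement {c ℓ : Level} (K : CommutativeRing c ℓ)
  (r : ℕ) (z : CommutativeRing.Carrier K) {n : ℕ} (G : SimpleGraph n) where
  open CommutativeRing K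
  open LinearForms K
  open SimpleGraph G renaming (sym to Adj-sym)

  ∈⇒HypIn : ∀ {A : Arr K n} {f} → A f → HypIn K A f
  ∈⇒HypIn {f = f} f∈A = f , f∈A , λ v → (λ h → h) , (λ h → h)

  M-mono : ∀ {P Q : Fin n → Set} → (∀ {a} → P a → Q a) →
    ∀ {f} → M K G P r z f → M K G Q r z f
  M-mono P⇒Q (lift (inj₁ (a , b , k , Pa , Pb , edge))) =
    lift (inj₁ (a , b , k , P⇒Q Pa , P⇒Q Pb , edge))
  M-mono P⇒Q (lift (inj₂ (a , Pa , vertex)))           = lift (inj₂ (a , P⇒Q Pa , vertex))

  M-empty : ∀ {P : Fin n → Set} → (∀ a → ¬ P a) → ∀ f → ¬ M K G P r z f
  M-empty ¬P _ (lift (inj₁ (a , _ , _ , Pa , _))) = ¬P a Pa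
  M-empty ¬P _ (lift (inj₂ (a , Pa , _)))         = ¬P a Pa

  A : ℕ → Arr K n
  A i = M K G (Prefix i) r z

  coord∈A : ∀ {i} b → toℕ b < i → A i (coord K b)
  coord∈A b b<i = lift (inj₂ (b , b<i , λ _ → refl))

  center-A : ∀ i v → Center K (A i) v ⇔ ZeroBelow i v
  center-A i v = mk⇔
    (λ v-central a a<i → to (cuts-coord a v) (v-central (coord K a) (coord∈A a a<i)))
    (λ v-zero → λ
      { f (lift (inj₂ (a , a<i , f≈xₐ))) →
          from (cuts-cong f≈xₐ (cuts-coord a) v) (v-zero a a<i)
      ; f (lift (inj₁ (a , b , k , a<i , b<i , _ , _ , _ , f≈xₐ-zᵏx_b))) →
          from (cuts-cong f≈xₐ-zᵏx_b (cuts-diffForm z k a b) v)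
            (trans (v-zero a a<i) (sym (trans (*-congˡ (v-zero b b<i)) (zeroʳ _))))
      })

  sameIndex : ∀ {a b : Fin n} {i} → toℕ a ≡ i → toℕ b ≡ i → a ≡ b
  sameIndex a≡i b≡i = Finₚ.toℕ-injective (≡.trans a≡i (≡.sym b≡i))

  module Supersolvable (isField : IsField K) (1≤r : 1 ≤ r) (z-primitive : IsPrimitiveRoot K r z)
    (peo : IsPEO G) where
    open RootsOfUnity K z
    open Period r 1≤r (proj₁ z-primitive)
    open import Relation.Binary.Reasoning.Setoid setoid

    -- The hyperplanes of A (suc i) outside A i; vertex number i is v_{i+1}.
    data New (i : ℕ) (f : Form K n) : Set (c ⊔ ℓ) where
      vertex : ∀ a → toℕ a ≡ i → Cuts f (λ v → v a ≈ 0#) → New i f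
      edge   : ∀ a b e → toℕ a ≡ i → toℕ b < i → Adj a b → e < r →
               Cuts f (λ v → v a ≈ pow K z e * v b) → New i f

    new : ∀ {i f} → A (suc i) f → ¬ HypIn K (A i) f → New i f
    new (lift (inj₂ (a , a≤i , f≈xₐ))) f∉Aᵢ with ℕₚ.m<1+n⇒m<n∨m≡n a≤i
    ... | inj₁ a<i = ⊥-elim (f∉Aᵢ (∈⇒HypIn (lift (inj₂ (a , a<i , f≈xₐ)))))
    ... | inj₂ a≡i = vertex a a≡i (cuts-cong f≈xₐ (cuts-coord a))
    new (lift (inj₁ (a , b , k , a≤i , b≤i , a~b , 1≤k , k≤r , f≈g))) f∉Aᵢ
      with ℕₚ.m<1+n⇒m<n∨m≡n a≤i | ℕₚ.m<1+n⇒m<n∨m≡n b≤i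
    ... | inj₁ a<i | inj₁ b<i =
      ⊥-elim (f∉Aᵢ (∈⇒HypIn (lift (inj₁ (a , b , k , a<i , b<i , a~b , 1≤k , k≤r , f≈g)))))
    ... | inj₂ a≡i | inj₂ b≡i =
      ⊥-elim (irrfl (≡.subst (Adj a) (≡.sym (sameIndex a≡i b≡i)) a~b))
    ... | inj₂ a≡i | inj₁ b<i = edge a b (k % r) a≡i b<i a~b (m%n<n k r)
      (cuts-resp (cuts-cong f≈g (cuts-diffForm z k a b)) (λ _ → pow-mod-⇔ {k}))
    ... | inj₁ a<i | inj₂ b≡i = edge b a ((r ℕ.∸ k) % r) b≡i a<i (Adj-sym a~b) (m%n<n _ r)
      (cuts-resp (cuts-resp (cuts-cong f≈g (cuts-diffForm z k a b)) (λ _ → pow-transpose k≤r))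
        (λ _ → pow-mod-⇔ {r ℕ.∸ k}))

    Below : ℕ → Form K n → Form K n → Set (c ⊔ ℓ)
    Below i f f' = ∃ λ g → A i g × (∀ v → ker K f v → ker K f' v → ker K g v)

    below-sym : ∀ {i f f'} → Below i f f' → Below i f' f
    below-sym (g , g∈Aᵢ , g⊇) = g , g∈Aᵢ , λ v f'v fv → g⊇ v fv f'v

    below-coord : ∀ {i f f'} b → toℕ b < i →
      (∀ v → ker K f v → ker K f' v → v b ≈ 0#) → Below i f f'
    below-coord b b<i x_b≈0 =
      coord K b , coord∈A b b<i , λ v fv f'v → from (cuts-coord b v) (x_b≈0 v fv f'v)

    vertex-edge-below : ∀ {i f f' a b e} → toℕ b < i → e < r →
      Cuts f (λ v → v a ≈ 0#) → Cuts f' (λ v → v a ≈ pow K z e * v b) → Below i f f'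
    vertex-edge-below b<i e<r f-cuts f'-cuts = below-coord _ b<i λ v fv f'v →
      trans (to (pow-transpose (ℕₚ.<⇒≤ e<r)) (to (f'-cuts v) f'v))
            (trans (*-congˡ (to (f-cuts v) fv)) (zeroʳ _))

    -- The elimination property makes the two earlier neighbours b, b' of a adjacent.
    edge-edge-below : ∀ {i f f' a b b' e e'} → toℕ a ≡ i → toℕ b < i → toℕ b' < i →
      Adj a b → Adj a b' → b ≢ b' → e < r →
      Cuts f (λ v → v a ≈ pow K z e * v b) → Cuts f' (λ v → v a ≈ pow K z e' * v b') →
      Below i f f'
    edge-edge-below {i} {a = a} {b} {b'} {e} {e'} a≡i b<i b'<i a~b a~b' b≢b' e<r f-cuts f'-cuts
      with pow-positive-exponent (r ℕ.∸ e ℕ.+ e')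
    ... | k , 1≤k , k≤r , zᵏ≈ =
      diffForm K z k b b' ,
      lift (inj₁ (b , b' , k , b<i , b'<i , b~b' , 1≤k , k≤r , λ _ → refl)) ,
      λ v fv f'v → from (cuts-diffForm z k b b' v) (begin
        v b                                      ≈⟨ to (pow-transpose (ℕₚ.<⇒≤ e<r)) (to (f-cuts v) fv) ⟩
        pow K z (r ℕ.∸ e) * v a                  ≈⟨ *-congˡ (to (f'-cuts v) f'v) ⟩
        pow K z (r ℕ.∸ e) * (pow K z e' * v b')  ≈⟨ *-assoc _ _ _ ⟨
        (pow K z (r ℕ.∸ e) * pow K z e') * v b'  ≈⟨ *-congʳ (pow-+ (r ℕ.∸ e) e') ⟨
        pow K z (r ℕ.∸ e ℕ.+ e') * v b'          ≈⟨ *-congʳ zᵏ≈ ⟩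
        pow K z k * v b'                         ∎)
      where
      before-a : ∀ {x} → toℕ x < i → x Fin.< a
      before-a = ≡.subst (_ <_) (≡.sym a≡i)
      b~b' : Adj b b'
      b~b' = peo a b b' (before-a b<i) (before-a b'<i) b≢b' a~b a~b'

    modular : ∀ {i f f'} → New i f → New i f' → ¬ SameHyp K f f' → Below i f f'
    modular (vertex a a≡i f-cuts) (vertex a' a'≡i f'-cuts) f≉f' with sameIndex a≡i a'≡i
    ... | ≡.refl = ⊥-elim (f≉f' (cuts-sameHyp f-cuts f'-cuts))
    modular (vertex a a≡i f-cuts) (edge a' b e a'≡i b<i _ e<r f'-cuts) _ with sameIndex a≡i a'≡i
    ... | ≡.refl = vertex-edge-below b<i e<r f-cuts f'-cuts
    modular (edge a b e a≡i b<i _ e<r f-cuts) (vertex a' a'≡i f'-cuts) _ with sameIndex a≡i a'≡i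
    ... | ≡.refl = below-sym (vertex-edge-below b<i e<r f'-cuts f-cuts)
    modular (edge a b e a≡i b<i a~b e<r f-cuts) (edge a' b' e' a'≡i b'<i a~b' e'<r f'-cuts) f≉f'
      with sameIndex a≡i a'≡i
    ... | ≡.refl with b Fin.≟ b' | e ℕₚ.≟ e'
    ...   | yes ≡.refl | yes ≡.refl = ⊥-elim (f≉f' (cuts-sameHyp f-cuts f'-cuts))
    ...   | yes ≡.refl | no e≢e'    = below-coord b b<i λ v fv f'v →
      pow-distinct isField z-primitive e<r e'<r e≢e'
        (trans (sym (to (f-cuts v) fv)) (to (f'-cuts v) f'v))
    ...   | no b≢b'    | _          =
      edge-edge-below {e' = e'} a≡i b<i b'<i a~b a~b' b≢b' e<r f-cuts f'-cuts

    filtration : IsSupersolvableFiltration K (M K G AllVertices r z) A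
    filtration = record
      { empty0  = M-empty (λ _ ())
      ; mono    = λ _ _ _ → ∈⇒HypIn ∘ M-mono ℕₚ.m<n⇒m<1+n
      ; topˡ    = λ _ → ∈⇒HypIn ∘ M-mono (λ _ → tt)
      ; topʳ    = λ _ → ∈⇒HypIn ∘ M-mono (λ {a} _ → Finₚ.toℕ<n a)
      ; rank    = λ i _ i≤n → hasRank-coordinate (A i) i i≤n (center-A i)
      ; modular = λ _ _ _ _ f∈ f'∈ f∉ f'∉ → modular (new f∈ f∉) (new f'∈ f'∉)
      }

mainTheorem8 : {c ℓ : Level} (K : CommutativeRing c ℓ) → IsField K →
    (r : ℕ) → 1 ≤ r → (z : CommutativeRing.Carrier K) → IsPrimitiveRoot K r z →
    (n : ℕ) (G : SimpleGraph n) → IsPEO G →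
    IsSupersolvableFiltration K (M K G AllVertices r z) (λ i → M K G (Prefix i) r z)
    × IsSupersolvable K (M K G AllVertices r z)
mainTheorem8 K isField r 1≤r z z-primitive n G peo = filtration , (A , filtration)
  where open ChordalArrangement K r z G
        open Supersolvable isField 1≤r z-primitive peo
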